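{- Let $M$ be a modular lattice of finite length, and let $a,b\in M$. Then: (a) if $a\le b$ then $a^*\le b^*$; and (a$^\delta$) if $a\le b$ then $a^+\le b^+$. (b) $a\le a^{+*}\le a^*$; and (b$^\delta$) $a^+\le a^{*+}\le a$. (c) $a^{*+*}=a^*$; and (c$^\delta$) $a^{+*+}=a^+$. (d) if $a=a^{*+}$ and $b=b^{*+}$, then $a+b=(a+b)^{*+}$; and (d$^\delta$) if $a=a^{+*}$ and $b=b^{+*}$, then $a\cdot b=(a\cdot b)^{+*}$. (e) $a^++b^+=(a+b)^+$; and (e$^\delta$) $a^*\cdot b^*=(a\cdot b)^*$.
   Context: A partially ordered set is of finite length if every chain in it is finite. $+$ and $\cdot$ denote join and meet, $a\prec b$ means $b$ covers $a$, and $M$ has least element $0$ and greatest element $1$. For $a\in M$: - $a^*=\sup\{b:a\prec b\}$ if $a<1$, and $1^*=1$; - $a^+=\inf\{b:b\prec a\}$ if $a>0$, and $0^+=0$. Iterates are read left to right; for example, $a^{*+}=(a^*)^+$. -}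

module Defs where

open import Level using (Level; _⊔_; suc)
open import Data.Product using (Σ; ∃; _×_; _,_)
open import Data.Sum using (_⊎_)
open import Data.List using (List)
open import Data.List.Relation.Unary.Any using (Any)
open import Relation.Nullary using (¬_)
open import Relation.Unary using (Pred)
open import Relation.Binary.Lattice using (BoundedLattice)

-- Notions about a bounded lattice L (order-theoretic bundle from the
-- standard library: _≈_ setoid equality, _≤_ order, _∨_ join (+),
-- _∧_ meet (·), ⊤ = 1, ⊥ = 0).
module Notions {c ℓ₁ ℓ₂ : Level} (L : BoundedLattice c ℓ₁ ℓ₂) where
  open BoundedLattice L

  _<_ : Carrier → Carrier → Set (ℓ₁ ⊔ ℓ₂)
  x < y = (x ≤ y) × ¬ (x ≈ y)

  _≺_ : Carrier → Carrier → Set (c ⊔ ℓ₁ ⊔ ℓ₂)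
  a ≺ b = (a < b) × ¬ (Σ Carrier λ z → (a < z) × (z < b))

  IsModular : Set (c ⊔ ℓ₁ ⊔ ℓ₂)
  IsModular = ∀ x y z → x ≤ z → (x ∨ (y ∧ z)) ≈ ((x ∨ y) ∧ z)

  IsChain : Pred Carrier (c ⊔ ℓ₁ ⊔ ℓ₂) → Set (c ⊔ ℓ₁ ⊔ ℓ₂)
  IsChain C = ∀ x y → C x → C y → (x ≤ y) ⊎ (y ≤ x)

  IsFiniteSubset : Pred Carrier (c ⊔ ℓ₁ ⊔ ℓ₂) → Set (c ⊔ ℓ₁ ⊔ ℓ₂)
  IsFiniteSubset C = Σ (List Carrier) λ xs → ∀ x → C x → Any (x ≈_) xs

  FiniteLength : Set (suc (c ⊔ ℓ₁ ⊔ ℓ₂))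
  FiniteLength = (C : Pred Carrier (c ⊔ ℓ₁ ⊔ ℓ₂)) → IsChain C → IsFiniteSubset C

  IsSup : {ℓ : Level} → Pred Carrier ℓ → Carrier → Set (c ⊔ ℓ ⊔ ℓ₂)
  IsSup S s = (∀ x → S x → x ≤ s) × (∀ u → (∀ x → S x → x ≤ u) → s ≤ u)

  IsInf : {ℓ : Level} → Pred Carrier ℓ → Carrier → Set (c ⊔ ℓ ⊔ ℓ₂)
  IsInf S s = (∀ x → S x → s ≤ x) × (∀ u → (∀ x → S x → u ≤ x) → u ≤ s)

  IsStar : (Carrier → Carrier) → Set (c ⊔ ℓ₁ ⊔ ℓ₂)
  IsStar star = ∀ a → ((a < ⊤) → IsSup (a ≺_) (star a)) × ((a ≈ ⊤) → star a ≈ ⊤)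

  IsPlus : (Carrier → Carrier) → Set (c ⊔ ℓ₁ ⊔ ℓ₂)
  IsPlus plus = ∀ a → ((⊥ < a) → IsInf (_≺ a) (plus a)) × ((a ≈ ⊥) → plus a ≈ ⊥)

{-# OPTIONS --safe #-}

-- In a modular lattice covers transpose: if a ≺ k and a ≤ b, then k ≤ b or b ≺ b + k, and
-- dually.  This makes * monotone, and a minimal counterexample in the interval [a⁺, a] shows
-- a ≤ a⁺* (finite length provides the minimal counterexample); dually a*⁺ ≤ a, passing to
-- the order dual, which swaps * and ⁺.  Hence ⁺ is lower adjoint to *, i.e. a⁺ ≤ b ⇔ a ≤ b*,
-- and (a)–(e) are standard facts about Galois connections together with a⁺ ≤ a ≤ a*.
module Submission where

open import Defs
open import Level using (_⊔_; Lift; lift; lower)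
open import Function using (_∘_)
open import Data.Product using (Σ; ∃; ∃₂; _×_; _,_; proj₁; proj₂; map₁; swap)
open import Data.Sum using (_⊎_; inj₁; inj₂)
import Data.Sum as Sum
open import Data.Nat as ℕ using (ℕ; zero; suc)
open import Data.Nat.Properties using (<-cmp; n<1+n; m≤n⇒m<n∨m≡n)
open import Data.Fin using (toℕ)
open import Data.Fin.Properties using (pigeonhole)
open import Data.List using (length; lookup)
open import Data.List.Relation.Unary.Any as Any using (Any)
open import Data.List.Relation.Unary.Any.Properties using (lookup-index)
open import Relation.Nullary using (¬_; yes; no; contradiction)
open import Relation.Nullary.Decidable using (map′; decidable-stable)
open import Relation.Unary using (Pred)
open import Relation.Binary using (tri<; tri≈; tri>)
open import Relation.Binary.Bundles using (Poset)
open import Relation.Binary.Definitions using (Decidable; Adjoint)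
import Relation.Binary.PropositionalEquality as ≡
open import Relation.Binary.Lattice using (Lattice; BoundedLattice)
open import Axiom.ExcludedMiddle using (ExcludedMiddle)
import Relation.Binary.Lattice.Properties.Lattice as LatticeProperties
import Relation.Binary.Lattice.Properties.JoinSemilattice as JoinProperties
import Relation.Binary.Lattice.Properties.MeetSemilattice as MeetProperties
import Relation.Binary.Properties.Poset as PosetProperties
import Relation.Binary.Reasoning.Setoid as ≈-Reasoning
import Relation.Binary.Reasoning.PartialOrder as ≤-Reasoning

module Classical {c ℓ₁ ℓ₂} (em : ExcludedMiddle (c ⊔ ℓ₁ ⊔ ℓ₂)) (L : BoundedLattice c ℓ₁ ℓ₂) where
  open BoundedLattice L

  _≤?_ : Decidable _≤_
  x ≤? y = map′ lower (lift {ℓ = c ⊔ ℓ₁}) em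

  _≟_ : Decidable _≈_
  x ≟ y = map′ lower (lift {ℓ = c ⊔ ℓ₂}) em

module Dual {c ℓ₁ ℓ₂} (L : BoundedLattice c ℓ₁ ℓ₂) where
  open BoundedLattice L
  open Notions L
  open LatticeProperties lattice using (∧-∨-isLattice)
  open JoinProperties joinSemilattice using (∨-comm; ∨-cong)
  open MeetProperties meetSemilattice using (∧-comm; ∧-cong)

  dual : BoundedLattice c ℓ₁ ℓ₂
  dual = record
    { _∨_ = _∧_ ; _∧_ = _∨_ ; ⊤ = ⊥ ; ⊥ = ⊤
    ; isBoundedLattice = record { isLattice = ∧-∨-isLattice ; maximum = minimum ; minimum = maximum }
    }

  module D = Notions dual

  private variable
    a b s x y : Carrier

  <-fromDual : x D.< y → y < x
  <-fromDual (y≤x , x≉y) = y≤x , x≉y ∘ Eq.sym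

  <-toDual : y < x → x D.< y
  <-toDual (y≤x , y≉x) = y≤x , y≉x ∘ Eq.sym

  ≺-fromDual : a D.≺ b → b ≺ a
  ≺-fromDual (a<b , nothing-between) =
    <-fromDual a<b , λ (z , b<z , z<a) → nothing-between (z , <-toDual z<a , <-toDual b<z)

  ≺-toDual : b ≺ a → a D.≺ b
  ≺-toDual (b<a , nothing-between) =
    <-toDual b<a , λ (z , a<z , z<b) → nothing-between (z , <-fromDual z<b , <-fromDual a<z)

  dual-isModular : IsModular → D.IsModular
  dual-isModular modular x y z z≤x = begin
    x ∧ (y ∨ z)  ≈⟨ ∧-comm x _ ⟩
    (y ∨ z) ∧ x  ≈⟨ ∧-cong (∨-comm y z) Eq.refl ⟩
    (z ∨ y) ∧ x  ≈⟨ modular z y x z≤x ⟨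
    z ∨ (y ∧ x)  ≈⟨ ∨-comm z _ ⟩
    (y ∧ x) ∨ z  ≈⟨ ∨-cong (∧-comm y x) Eq.refl ⟩
    (x ∧ y) ∨ z  ∎
    where open ≈-Reasoning setoid

  dual-finiteLength : FiniteLength → D.FiniteLength
  dual-finiteLength fl C chain = fl C λ x y Cx Cy → Sum.swap (chain x y Cx Cy)

  isPlus⇒dual-isStar : ∀ {plus} → IsPlus plus → D.IsStar plus
  isPlus⇒dual-isStar isPlus a = map₁ (λ inf a<⊥ → lower-covers (inf (<-fromDual a<⊥))) (isPlus a)
    where
    lower-covers : IsInf (_≺ a) s → D.IsSup (a D.≺_) s
    lower-covers (lb , greatest) =
      (λ x → lb x ∘ ≺-fromDual) , (λ u bound → greatest u λ x → bound x ∘ ≺-toDual)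

  isStar⇒dual-isPlus : ∀ {star} → IsStar star → D.IsPlus star
  isStar⇒dual-isPlus isStar a = map₁ (λ sup ⊤<a → upper-covers (sup (<-fromDual ⊤<a))) (isStar a)
    where
    upper-covers : IsSup (a ≺_) s → D.IsInf (D._≺ a) s
    upper-covers (ub , least) =
      (λ x → ub x ∘ ≺-fromDual) , (λ u bound → least u λ x → bound x ∘ ≺-toDual)

module WellFoundedness {c ℓ₁ ℓ₂} (em : ExcludedMiddle (c ⊔ ℓ₁ ⊔ ℓ₂))
  (L : BoundedLattice c ℓ₁ ℓ₂) (fl : Notions.FiniteLength L) where
  open BoundedLattice L
  open Notions L
  open PosetProperties poset using (<-trans; <⇒≉)

  Descending : (ℕ → Carrier) → Set (ℓ₁ ⊔ ℓ₂)
  Descending s = ∀ n → s (suc n) < s n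

  descending-< : ∀ {s} → Descending s → ∀ {m n} → m ℕ.< n → s n < s m
  descending-< desc {n = suc n} (ℕ.s≤s m≤n) with m≤n⇒m<n∨m≡n m≤n
  ... | inj₁ m<n     = <-trans (desc n) (descending-< desc m<n)
  ... | inj₂ ≡.refl = desc n

  Image : (ℕ → Carrier) → Pred Carrier (c ⊔ ℓ₁ ⊔ ℓ₂)
  Image s z = Lift (ℓ₁ ⊔ ℓ₂) (∃ λ n → s n ≡.≡ z)

  descending-image-isChain : ∀ {s} → Descending s → IsChain (Image s)
  descending-image-isChain desc _ _ (lift (m , ≡.refl)) (lift (n , ≡.refl)) with <-cmp m n
  ... | tri< m<n _ _     = inj₂ (proj₁ (descending-< desc m<n))
  ... | tri≈ _ ≡.refl _ = inj₁ refl
  ... | tri> _ _ n<m     = inj₁ (proj₁ (descending-< desc n<m))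

  sequence-in-list-repeats : ∀ {s : ℕ → Carrier} xs → (∀ n → Any (s n ≈_) xs) →
                             ∃₂ λ m n → m ℕ.< n × s m ≈ s n
  sequence-in-list-repeats {s} xs s∈xs
    with i , j , i<j , same-position ← pigeonhole (n<1+n (length xs)) (Any.index ∘ s∈xs ∘ toℕ)
    = toℕ i , toℕ j , i<j , (begin
        s (toℕ i)                            ≈⟨ lookup-index (s∈xs (toℕ i)) ⟩
        lookup xs (Any.index (s∈xs (toℕ i))) ≡⟨ ≡.cong (lookup xs) same-position ⟩
        lookup xs (Any.index (s∈xs (toℕ j))) ≈⟨ lookup-index (s∈xs (toℕ j)) ⟨
        s (toℕ j)                            ∎)
    where open ≈-Reasoning setoid

  no-descending-sequence : ∀ {s} → ¬ Descending s
  no-descending-sequence {s} desc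
    with xs , ∈xs ← fl (Image s) (descending-image-isChain desc)
    with m , n , m<n , sₘ≈sₙ ← sequence-in-list-repeats xs (λ n → ∈xs (s n) (lift (n , ≡.refl)))
    = <⇒≉ (descending-< desc m<n) (Eq.sym sₘ≈sₙ)

  no-infinite-descent : ∀ {q} {Q : Pred Carrier q} →
                        (∀ y → Q y → ∃ λ z → z < y × Q z) → ∀ {x} → ¬ Q x
  no-infinite-descent {Q = Q} smaller {x} Qx =
    no-descending-sequence {s = proj₁ ∘ walk} (λ n → proj₁ (proj₂ (next (walk n))))
    where
    next : (y : Σ Carrier Q) → ∃ λ z → z < proj₁ y × Q z
    next (y , Qy) = smaller y Qy
    walk : ℕ → Σ Carrier Q
    walk zero    = x , Qx
    walk (suc n) = proj₁ (next (walk n)) , proj₂ (proj₂ (next (walk n)))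

  Minimal : Pred Carrier (ℓ₁ ⊔ ℓ₂) → Pred Carrier (c ⊔ ℓ₁ ⊔ ℓ₂)
  Minimal Q y = Q y × (∀ z → z < y → ¬ Q z)

  minimal-exists : ∀ {Q : Pred Carrier (ℓ₁ ⊔ ℓ₂)} {x} → Q x → ∃ (Minimal Q)
  minimal-exists Qx = decidable-stable em λ no-minimal →
    no-infinite-descent
      (λ y Qy → decidable-stable em λ none-smaller →
                  no-minimal (y , Qy , λ z z<y Qz → none-smaller (z , z<y , Qz)))
      Qx

module Covers {c ℓ₁ ℓ₂} (em : ExcludedMiddle (c ⊔ ℓ₁ ⊔ ℓ₂)) (L : BoundedLattice c ℓ₁ ℓ₂)
  (modular : Notions.IsModular L) (fl : Notions.FiniteLength L) where
  open BoundedLattice L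
  open Notions L
  open Classical em L
  open WellFoundedness em L fl
  open PosetProperties poset using (<⇒≱)
  open ≤-Reasoning poset

  private variable
    a b k u w x y : Carrier

  cover-interval : a ≺ k → a ≤ w → w ≤ k → w ≈ a ⊎ w ≈ k
  cover-interval {a} {k} {w} (_ , nothing-between) a≤w w≤k with w ≟ a | w ≟ k
  ... | yes w≈a | _       = inj₁ w≈a
  ... | no _    | yes w≈k = inj₂ w≈k
  ... | no w≉a  | no w≉k  = contradiction (w , (a≤w , w≉a ∘ Eq.sym) , (w≤k , w≉k)) nothing-between

  cover-squeeze : w ≺ x → w ≤ y → y < x → y ≈ w
  cover-squeeze w≺x w≤y (y≤x , y≉x) with cover-interval w≺x w≤y y≤x
  ... | inj₁ y≈w = y≈w
  ... | inj₂ y≈x = contradiction y≈x y≉x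

  cover-between : x < y → ∃ λ k → x ≺ k × k ≤ y
  cover-between {x} {y} x<y
    with k , (x<k , k≤y) , k-minimal ← minimal-exists {Q = λ k → x < k × k ≤ y} (x<y , refl)
    = k , (x<k , λ (z , x<z , z<k) → k-minimal z z<k (x<z , trans (proj₁ z<k) k≤y)) , k≤y

  -- For b < z < b + k, modularity gives z = b + k · z, and k · z is a or k since a ≺ k.
  ≺-transpose : a ≺ k → a ≤ b → k ≤ b ⊎ b ≺ (b ∨ k)
  ≺-transpose {a} {k} {b} a≺k a≤b with k ≤? b
  ... | yes k≤b = inj₁ k≤b
  ... | no k≰b  = inj₂ (b<b∨k , nothing-between)
    where
    b<b∨k : b < (b ∨ k)
    b<b∨k = x≤x∨y b k , λ b≈b∨k → k≰b (trans (y≤x∨y b k) (reflexive (Eq.sym b≈b∨k)))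

    nothing-between : ¬ ∃ λ z → b < z × z < (b ∨ k)
    nothing-between (z , b<z , z<b∨k)
      with cover-interval a≺k (∧-greatest (proj₁ (proj₁ a≺k)) (trans a≤b (proj₁ b<z))) (x∧y≤x k z)
    ... | inj₁ k∧z≈a = <⇒≱ b<z (begin
          z                ≤⟨ ∧-greatest (proj₁ z<b∨k) refl ⟩
          (b ∨ k) ∧ z      ≈⟨ modular b k z (proj₁ b<z) ⟨
          b ∨ (k ∧ z)      ≤⟨ ∨-least refl (trans (reflexive k∧z≈a) a≤b) ⟩
          b                ∎)
    ... | inj₂ k∧z≈k = <⇒≱ z<b∨k (∨-least (proj₁ b<z) (trans (reflexive (Eq.sym k∧z≈k)) (x∧y≤y k z)))

  module StarLemmas {star : Carrier → Carrier} (isStar : IsStar star) where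

    cover≤star : a ≺ k → k ≤ star a
    cover≤star {a} {k} a≺k = proj₁ (proj₁ (isStar a) a<⊤) k a≺k
      where
      a<⊤ : a < ⊤
      a<⊤ = begin-strict a <⟨ proj₁ a≺k ⟩ k ≤⟨ maximum k ⟩ ⊤ ∎

    star-least : a < ⊤ → (∀ k → a ≺ k → k ≤ u) → star a ≤ u
    star-least {a} {u} a<⊤ = proj₂ (proj₁ (isStar a) a<⊤) u

    ≤-star-of-⊤ : a ≈ ⊤ → x ≤ star a
    ≤-star-of-⊤ {a} {x} a≈⊤ = trans (maximum x) (reflexive (Eq.sym (proj₂ (isStar a) a≈⊤)))

    star-inflationary : ∀ a → a ≤ star a
    star-inflationary a with a ≟ ⊤
    ... | yes a≈⊤ = ≤-star-of-⊤ a≈⊤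
    ... | no a≉⊤ with k , a≺k , _ ← cover-between (maximum a , a≉⊤)
      = trans (proj₁ (proj₁ a≺k)) (cover≤star a≺k)

    star-monotone : a ≤ b → star a ≤ star b
    star-monotone {a} {b} a≤b with b ≟ ⊤
    ... | yes b≈⊤ = ≤-star-of-⊤ b≈⊤
    ... | no b≉⊤  = star-least (begin-strict a ≤⟨ a≤b ⟩ b <⟨ maximum b , b≉⊤ ⟩ ⊤ ∎) covers≤star-b
      where
      covers≤star-b : ∀ k → a ≺ k → k ≤ star b
      covers≤star-b k a≺k with ≺-transpose a≺k a≤b
      ... | inj₁ k≤b   = trans k≤b (star-inflationary b)
      ... | inj₂ b≺b∨k = trans (y≤x∨y b k) (cover≤star b≺b∨k)

module Operators {c ℓ₁ ℓ₂} (em : ExcludedMiddle (c ⊔ ℓ₁ ⊔ ℓ₂)) (L : BoundedLattice c ℓ₁ ℓ₂)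
  (modular : Notions.IsModular L) (fl : Notions.FiniteLength L)
  {star plus : BoundedLattice.Carrier L → BoundedLattice.Carrier L}
  (isStar : Notions.IsStar L star) (isPlus : Notions.IsPlus L plus) where
  open BoundedLattice L
  open Notions L
  open Classical em L
  open WellFoundedness em L fl
  open Covers em L modular fl
  open StarLemmas isStar public
  open Dual L
  open Poset poset using (_≰_)
  open PosetProperties poset using (<⇒≱)
  private
    module DualCovers = Covers em dual (dual-isModular modular) (dual-finiteLength fl)
    module PlusLemmas = DualCovers.StarLemmas (isPlus⇒dual-isStar isPlus)

  private variable
    a b f k p u x y : Carrier

  ≺-transposeᵒ : k ≺ a → b ≤ a → b ≤ k ⊎ (b ∧ k) ≺ b
  ≺-transposeᵒ k≺a b≤a = Sum.map₂ ≺-fromDual (DualCovers.≺-transpose (≺-toDual k≺a) b≤a)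

  plus≤lower-cover : f ≺ a → plus a ≤ f
  plus≤lower-cover f≺a = PlusLemmas.cover≤star (≺-toDual f≺a)

  plus-greatest : ⊥ < a → (∀ f → f ≺ a → u ≤ f) → u ≤ plus a
  plus-greatest ⊥<a lower-bound = PlusLemmas.star-least (<-toDual ⊥<a) λ f → lower-bound f ∘ ≺-fromDual

  plus-deflationary : ∀ a → plus a ≤ a
  plus-deflationary = PlusLemmas.star-inflationary

  x∧y<x : x ≰ y → (x ∧ y) < x
  x∧y<x {x} {y} x≰y = x∧y≤x x y , λ x∧y≈x → x≰y (trans (reflexive (Eq.sym x∧y≈x)) (x∧y≤y x y))

  -- Otherwise x covers p, so x ≤ star p.
  x∧star[p]≰p : p ≤ x → x ≰ star p → (∀ z → p ≤ z → z < x → z ≤ star p) → x ∧ star p ≰ p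
  x∧star[p]≰p {p} {x} p≤x x≰star[p] below x∧star[p]≤p = x≰star[p] (cover≤star p≺x)
    where
    p≺x : p ≺ x
    p≺x = (p≤x , λ p≈x → x≰star[p] (trans (reflexive (Eq.sym p≈x)) (star-inflationary p)))
        , λ (z , p<z , z<x) → <⇒≱ p<z (trans (∧-greatest (proj₁ z<x) (below z (proj₁ p<z) z<x)) x∧star[p]≤p)

  -- Every lower cover f of a either lies above x or transposes to the lower cover x · f of x,
  -- which is squeezed onto x · u.
  x∧u≤plus[a] : ⊥ < a → plus a ≤ x → x ≤ a → x ≰ u →
                (∀ z → plus a ≤ z → z < x → z ≤ u) → x ∧ u ≤ plus a
  x∧u≤plus[a] {a} {x} {u} ⊥<a p≤x x≤a x≰u below = plus-greatest ⊥<a x∧u≤lower-cover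
    where
    x∧u≤lower-cover : ∀ f → f ≺ a → x ∧ u ≤ f
    x∧u≤lower-cover f f≺a with ≺-transposeᵒ f≺a x≤a
    ... | inj₁ x≤f   = trans (x∧y≤x x u) x≤f
    ... | inj₂ x∧f≺x = trans (reflexive (cover-squeeze x∧f≺x x∧f≤x∧u (x∧y<x x≰u))) (x∧y≤y x f)
      where
      x∧f≤x∧u : x ∧ f ≤ x ∧ u
      x∧f≤x∧u = ∧-greatest (x∧y≤x x f)
                  (below (x ∧ f) (∧-greatest p≤x (plus≤lower-cover f≺a)) (proj₁ x∧f≺x))

  Counterexample : Carrier → Pred Carrier (ℓ₁ ⊔ ℓ₂)
  Counterexample a x = Lift ℓ₁ (plus a ≤ x × x ≤ a × x ≰ star (plus a))

  no-minimal-counterexample : ⊥ < a → ¬ Minimal (Counterexample a) x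
  no-minimal-counterexample {a} {x} ⊥<a (lift (p≤x , x≤a , x≰star[p]) , minimal) =
    x∧star[p]≰p p≤x x≰star[p] below (x∧u≤plus[a] ⊥<a p≤x x≤a x≰star[p] below)
    where
    below : ∀ z → plus a ≤ z → z < x → z ≤ star (plus a)
    below z p≤z z<x = decidable-stable (z ≤? _) λ z≰star[p] →
      minimal z z<x (lift (p≤z , trans (proj₁ z<x) x≤a , z≰star[p]))

  ≤-star-plus : ∀ a → a ≤ star (plus a)
  ≤-star-plus a with a ≟ ⊥
  ... | yes a≈⊥ = trans (reflexive a≈⊥) (minimum _)
  ... | no a≉⊥  = decidable-stable (a ≤? _) λ a≰star[p] →
    no-minimal-counterexample (minimum a , a≉⊥ ∘ Eq.sym)
      (proj₂ (minimal-exists {Q = Counterexample a} (lift (plus-deflationary a , refl , a≰star[p]))))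

module Adjunction {c ℓ₁ ℓ₂} (em : ExcludedMiddle (c ⊔ ℓ₁ ⊔ ℓ₂)) (L : BoundedLattice c ℓ₁ ℓ₂)
  (modular : Notions.IsModular L) (fl : Notions.FiniteLength L)
  {star plus : BoundedLattice.Carrier L → BoundedLattice.Carrier L}
  (isStar : Notions.IsStar L star) (isPlus : Notions.IsPlus L plus) where
  open BoundedLattice L
  open Dual L
  open Operators em L modular fl isStar isPlus public
    using (star-inflationary; plus-deflationary; star-monotone; ≤-star-plus)
  private
    module DualOperators = Operators em dual (dual-isModular modular) (dual-finiteLength fl)
                             (isPlus⇒dual-isStar isPlus) (isStar⇒dual-isPlus isStar)

  plus-monotone : ∀ {x y} → x ≤ y → plus x ≤ plus y
  plus-monotone = DualOperators.star-monotone

  plus-star-≤ : ∀ x → plus (star x) ≤ x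
  plus-star-≤ = DualOperators.≤-star-plus

  plus⊣star : Adjoint _≤_ _≤_ plus star
  plus⊣star = (λ plus[x]≤y → trans (≤-star-plus _) (star-monotone plus[x]≤y))
            , (λ x≤star[y] → trans (plus-monotone x≤star[y]) (plus-star-≤ _))

module LowerAdjoint {c ℓ₁ ℓ₂} (L : Lattice c ℓ₁ ℓ₂)
  {f g : Lattice.Carrier L → Lattice.Carrier L} (f⊣g : Adjoint (Lattice._≤_ L) (Lattice._≤_ L) f g) where
  open Lattice L

  unit : ∀ x → x ≤ g (f x)
  unit x = proj₁ f⊣g refl

  counit : ∀ y → f (g y) ≤ y
  counit y = proj₂ f⊣g refl

  f-monotone : ∀ {x y} → x ≤ y → f x ≤ f y
  f-monotone x≤y = proj₂ f⊣g (trans x≤y (unit _))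

  fgf≈f : ∀ x → f (g (f x)) ≈ f x
  fgf≈f x = antisym (counit (f x)) (f-monotone (unit x))

  f-∨-distrib : ∀ x y → f x ∨ f y ≈ f (x ∨ y)
  f-∨-distrib x y = antisym
    (∨-least (f-monotone (x≤x∨y x y)) (f-monotone (y≤x∨y x y)))
    (proj₂ f⊣g (∨-least (proj₁ f⊣g (x≤x∨y (f x) (f y))) (proj₁ f⊣g (y≤x∨y (f x) (f y)))))

  fg-monotone : ∀ {x y} → x ≤ y → f (g x) ≤ f (g y)
  fg-monotone x≤y = f-monotone (proj₁ f⊣g (trans (counit _) x≤y))

  fg-fixed-∨-closed : ∀ {x y} → x ≈ f (g x) → y ≈ f (g y) → x ∨ y ≈ f (g (x ∨ y))
  fg-fixed-∨-closed {x} {y} x≈fgx y≈fgy = antisym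
    (∨-least (trans (reflexive x≈fgx) (fg-monotone (x≤x∨y x y)))
             (trans (reflexive y≈fgy) (fg-monotone (y≤x∨y x y))))
    (counit (x ∨ y))

module GaloisConnection {c ℓ₁ ℓ₂} (L : Lattice c ℓ₁ ℓ₂)
  {f g : Lattice.Carrier L → Lattice.Carrier L} (f⊣g : Adjoint (Lattice._≤_ L) (Lattice._≤_ L) f g) where
  open LowerAdjoint L f⊣g public
  open LowerAdjoint (LatticeProperties.∧-∨-lattice L) (λ {x} {y} → swap (f⊣g {y} {x})) public
    using ()
    renaming (f-monotone to g-monotone; fgf≈f to gfg≈g; f-∨-distrib to g-∧-distrib;
              fg-fixed-∨-closed to gf-fixed-∧-closed)

lemma6p1 : ∀ {c ℓ₁ ℓ₂} → ExcludedMiddle (c ⊔ ℓ₁ ⊔ ℓ₂) →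
    (L : BoundedLattice c ℓ₁ ℓ₂) →
    let open BoundedLattice L
        open Notions L
    in IsModular → FiniteLength →
       (star plus : Carrier → Carrier) → IsStar star → IsPlus plus →
       ∀ a b →
         -- (a) and (a^δ)
         ((a ≤ b → star a ≤ star b) × (a ≤ b → plus a ≤ plus b)) ×
         -- (b) and (b^δ)
         ((a ≤ star (plus a) × star (plus a) ≤ star a) ×
          (plus a ≤ plus (star a) × plus (star a) ≤ a)) ×
         -- (c) and (c^δ)
         ((star (plus (star a)) ≈ star a) × (plus (star (plus a)) ≈ plus a)) ×
         -- (d) and (d^δ)
         ((a ≈ plus (star a) → b ≈ plus (star b) →
             (a ∨ b) ≈ plus (star (a ∨ b))) ×
          (a ≈ star (plus a) → b ≈ star (plus b) →
             (a ∧ b) ≈ star (plus (a ∧ b)))) ×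
         -- (e) and (e^δ)
         ((plus a ∨ plus b) ≈ plus (a ∨ b)) × ((star a ∧ star b) ≈ star (a ∧ b))
lemma6p1 em L modular fl star plus isStar isPlus a b =
    (g-monotone , f-monotone)
  , ((unit a , g-monotone (plus-deflationary a)) , (f-monotone (star-inflationary a) , counit a))
  , (gfg≈g a , fgf≈f a)
  , (fg-fixed-∨-closed , gf-fixed-∧-closed)
  , f-∨-distrib a b , g-∧-distrib a b
  where
  open BoundedLattice L using (lattice)
  open Adjunction em L modular fl isStar isPlus using (plus⊣star; plus-deflationary; star-inflationary)
  open GaloisConnection lattice plus⊣star
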